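{- Let $\mathbb F_q$ be a finite field with $q$ elements, let $n\ge 2$, let $a_1,\dots,a_n,b\in\mathbb F_q^*$, and let $m_1,\dots,m_n,k,k_1,\dots,k_n$ be positive integers. Put $d_j=\gcd(m_j,q-1)$ for $j=1,\dots,n$ and $M=\operatorname{lcm}[m_1,\dots,m_n]$. Assume that $\gcd\bigl(\sum_{j=1}^n k_jM/m_j-kM,\;q-1\bigr)=1$. Then $$ N[(a_1x_1^{m_1}+\dots+a_nx_n^{m_n})^k=bx_1^{k_1}\cdots x_n^{k_n}]=(q-1)^{n-1}+N[a_1x_1^{d_1}+\dots+a_nx_n^{d_n}=0]-\frac{q}{q-1}\,N^*[a_1x_1^{d_1}+\dots+a_nx_n^{d_n}=0]. $$
   Context: $\mathbb F_q^*=\mathbb F_q\setminus\{0\}$. For polynomials $f_1,f_2$ over $\mathbb F_q$ in $n$ variables, $N[f_1=f_2]$ denotes the number of solutions $(x_1,\dots,x_n)\in\mathbb F_q^n$ of $f_1(x_1,\dots,x_n)=f_2(x_1,\dots,x_n)$, and $N^*[f_1=f_2]$ denotes the number of such solutions with $x_1\cdots x_n\neq 0$. -}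

module Defs where

open import Level using (Level; _⊔_) renaming (suc to lsuc)
open import Algebra.Bundles using (CommutativeRing)
open import Data.Nat as ℕ using (ℕ; zero; suc)
open import Data.Nat.LCM using (lcm)
open import Data.Fin using (Fin; zero; suc)
open import Data.List using (List; []; _∷_; map; allFin)
open import Data.Nat.ListAction using (sum)
open import Data.Product using (∃; _,_)
open import Data.Bool using (Bool; true; false; if_then_else_; _∧_)
open import Relation.Nullary using (¬_; does)
open import Relation.Binary.Definitions using (Decidable)
open import Relation.Binary.PropositionalEquality using (_≡_)

-- A finite field: a commutative ring with decidable equality, 0 ≠ 1,
-- inverses of nonzero elements, and an enumeration of its elements by
-- Fin size (bijective up to the setoid equality _≈_).  size = q.
record FiniteField (c ℓ : Level) : Set (lsuc (c ⊔ ℓ)) where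
  field
    commutativeRing : CommutativeRing c ℓ
  open CommutativeRing commutativeRing public
  field
    _≟_       : Decidable _≈_
    0≉1       : ¬ (0# ≈ 1#)
    inverse   : ∀ x → ¬ (x ≈ 0#) → ∃ λ y → x * y ≈ 1#
    size      : ℕ
    enum      : Fin size → Carrier
    enum-surj : ∀ x → ∃ λ i → enum i ≈ x
    enum-inj  : ∀ {i j} → enum i ≈ enum j → i ≡ j

lcmAll : ∀ n → (Fin n → ℕ) → ℕ
lcmAll zero    m = 1
lcmAll (suc n) m = lcm (m zero) (lcmAll n (λ j → m (suc j)))

∑ℕ : ∀ n → (Fin n → ℕ) → ℕ
∑ℕ zero    f = 0
∑ℕ (suc n) f = f zero ℕ.+ ∑ℕ n (λ j → f (suc j))

module _ {c ℓ} (F : FiniteField c ℓ) where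
  open FiniteField F using (Carrier; _+_; _*_; 0#; 1#; _≟_; enum; size)

  pow : Carrier → ℕ → Carrier
  pow x zero    = 1#
  pow x (suc m) = x * pow x m

  ∑ : ∀ n → (Fin n → Carrier) → Carrier
  ∑ zero    f = 0#
  ∑ (suc n) f = f zero + ∑ n (λ j → f (suc j))

  ∏ : ∀ n → (Fin n → Carrier) → Carrier
  ∏ zero    f = 1#
  ∏ (suc n) f = f zero * ∏ n (λ j → f (suc j))

  countPts : ∀ n → ((Fin n → Carrier) → Bool) → ℕ
  countPts zero    t = if t (λ ()) then 1 else 0
  countPts (suc n) t =
    sum (map (λ i → countPts n (λ x → t (λ { zero → enum i ; (suc j) → x j })))
             (allFin size))

  allNonzero : ∀ n → (Fin n → Carrier) → Bool
  allNonzero zero    x = true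
  allNonzero (suc n) x = (Data.Bool.not (does (x zero ≟ 0#))) ∧ allNonzero n (λ j → x (suc j))

  N : ∀ n → ((Fin n → Carrier) → Carrier) → ((Fin n → Carrier) → Carrier) → ℕ
  N n f g = countPts n (λ x → does (f x ≟ g x))

  N* : ∀ n → ((Fin n → Carrier) → Carrier) → ((Fin n → Carrier) → Carrier) → ℕ
  N* n f g = countPts n (λ x → allNonzero n x ∧ does (f x ≟ g x))

module Submission where

-- A point with a zero coordinate makes the right-hand side vanish, so it is a solution exactly when
-- Σ aⱼxⱼ^mⱼ = 0. On the torus (F*)ⁿ the group F* acts by t·x = (t^(M/mⱼ) xⱼ), which multiplies
-- Σ aⱼxⱼ^mⱼ by t^M and b ∏ xⱼ^kⱼ by t^S, S = Σ kⱼM/mⱼ. So t·x is a solution iff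
-- t^(kM) (Σ aⱼxⱼ^mⱼ)^k = t^S b ∏ xⱼ^kⱼ, and since gcd(S - kM, q - 1) = 1 this has exactly one
-- root t ∈ F* when Σ aⱼxⱼ^mⱼ ≠ 0 and none otherwise. Summing over t and x,
-- (q - 1)·#{solutions on the torus} = #{torus points with Σ aⱼxⱼ^mⱼ ≠ 0}.
-- Finally y ↦ y^m and y ↦ y^gcd(m, q - 1) take every value equally often on F, so Σ aⱼxⱼ^mⱼ and
-- Σ aⱼxⱼ^dⱼ have equally many zeros, both on Fⁿ and on the torus; the formula is then arithmetic.

open import Defs
open import Algebra.Bundles using (CommutativeMonoid)
import Algebra.Properties.CommutativeMonoid.Sum as Sum
import Algebra.Properties.Semiring.Sum as SemiringSum
open import Data.Bool using (Bool; true; false; if_then_else_; not; _∧_)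
import Data.Bool.Properties as Bool
open import Data.Fin using (Fin; zero; suc)
import Data.Fin.Properties as Fin
open import Data.Fin.Permutation using (Permutation′; permutation)
open import Data.Integer as ℤ using (+_; 1ℤ; _⊖_)
import Data.Integer.Properties as ℤ
open import Data.Integer.GCD renaming (gcd to gcdℤ)
open import Data.List using (allFin; tabulate; map)
import Data.List.Properties as List
import Data.Nat.ListAction as List
open import Data.Nat as ℕ using (ℕ; zero; suc; NonZero; _≤_; _<_; _∸_; _/_)
import Data.Nat.Properties as ℕ
open import Data.Nat.Divisibility using (_∣_; ∣-trans; quotient)
open import Data.Nat.DivMod using (m/n*n≡m)
open import Data.Nat.GCD using (gcd; gcd-GCD; module Bézout; gcd[m,n]∣m; gcd[m,n]≢0)
open import Data.Nat.LCM using (m∣lcm[m,n]; n∣lcm[m,n])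
open import Data.Nat.Solver using (module +-*-Solver)
open import Data.Product using (Σ; ∃; _,_; proj₁; proj₂; _×_)
open import Data.Sum using (inj₁; inj₂)
open import Data.Vec.Functional using ([]; _∷_)
open import Data.Vec.Functional.Relation.Binary.Pointwise using (Pointwise)
open import Function using (_∘_; id)
open import Function.Bundles using (_⇔_; mk⇔; Equivalence)
open import Relation.Binary.Core using (_Preserves_⟶_)
import Relation.Binary.Reasoning.Setoid
open import Relation.Nullary using (¬_; yes; no; does; Dec)
open import Relation.Nullary.Decidable using (dec-true; dec-false; does-⇔)
open import Relation.Nullary.Negation using (contradiction)
open import Relation.Binary.PropositionalEquality as ≡ using (_≡_; _≢_)

module FieldAlgebra {c ℓ} (F : FiniteField c ℓ) where
  open FiniteField F
  open import Algebra.Properties.CommutativeSemigroup *-commutativeSemigroup public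
    using (interchange; x∙yz≈y∙xz)
  module ≈-Reasoning = Relation.Binary.Reasoning.Setoid setoid

  infixr 8 _^_
  _^_ : Carrier → ℕ → Carrier
  _^_ = pow F

  ^-congˡ : ∀ n {x y} → x ≈ y → x ^ n ≈ y ^ n
  ^-congˡ zero    _   = refl
  ^-congˡ (suc n) x≈y = *-cong x≈y (^-congˡ n x≈y)

  ^-homo-* : ∀ x m n → x ^ (m ℕ.+ n) ≈ x ^ m * x ^ n
  ^-homo-* x zero    n = sym (*-identityˡ _)
  ^-homo-* x (suc m) n = trans (*-congˡ (^-homo-* x m n)) (sym (*-assoc _ _ _))

  ^-distrib-* : ∀ x y n → (x * y) ^ n ≈ x ^ n * y ^ n
  ^-distrib-* x y zero    = sym (*-identityˡ _)
  ^-distrib-* x y (suc n) = trans (*-congˡ (^-distrib-* x y n)) (interchange x y (x ^ n) (y ^ n))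

  1^n≈1 : ∀ n → 1# ^ n ≈ 1#
  1^n≈1 zero    = refl
  1^n≈1 (suc n) = trans (*-identityˡ _) (1^n≈1 n)

  ^-assocʳ : ∀ x m n → (x ^ m) ^ n ≈ x ^ (m ℕ.* n)
  ^-assocʳ x zero    n = 1^n≈1 n
  ^-assocʳ x (suc m) n = begin
    (x * x ^ m) ^ n        ≈⟨ ^-distrib-* x (x ^ m) n ⟩
    x ^ n * (x ^ m) ^ n    ≈⟨ *-congˡ (^-assocʳ x m n) ⟩
    x ^ n * x ^ (m ℕ.* n)  ≈⟨ ^-homo-* x n (m ℕ.* n) ⟨
    x ^ (n ℕ.+ m ℕ.* n)    ∎
    where open ≈-Reasoning

  ^-comm : ∀ x m n → (x ^ m) ^ n ≈ (x ^ n) ^ m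
  ^-comm x m n = trans (^-assocʳ x m n)
    (trans (reflexive (≡.cong (x ^_) (ℕ.*-comm m n))) (sym (^-assocʳ x n m)))

  0^n≈0 : ∀ n .{{_ : NonZero n}} → 0# ^ n ≈ 0#
  0^n≈0 (suc n) = zeroˡ _

  1≉0 : 1# ≉ 0#
  1≉0 1≈0 = 0≉1 (sym 1≈0)

  *-cancelʳ : ∀ {x y z} → z ≉ 0# → x * z ≈ y * z → x ≈ y
  *-cancelʳ {x} {y} {z} z≉0 xz≈yz with inverse z z≉0
  ... | w , zw≈1 = begin
    x            ≈⟨ *-identityʳ x ⟨
    x * 1#       ≈⟨ *-congˡ zw≈1 ⟨
    x * (z * w)  ≈⟨ *-assoc x z w ⟨
    x * z * w    ≈⟨ *-congʳ xz≈yz ⟩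
    y * z * w    ≈⟨ *-assoc y z w ⟩
    y * (z * w)  ≈⟨ *-congˡ zw≈1 ⟩
    y * 1#       ≈⟨ *-identityʳ y ⟩
    y            ∎
    where open ≈-Reasoning

  *-cancelˡ : ∀ {x y z} → z ≉ 0# → z * x ≈ z * y → x ≈ y
  *-cancelˡ z≉0 zx≈zy = *-cancelʳ z≉0 (trans (*-comm _ _) (trans zx≈zy (*-comm _ _)))

  *-nonzero : ∀ {x y} → x ≉ 0# → y ≉ 0# → x * y ≉ 0#
  *-nonzero {x} {y} x≉0 y≉0 xy≈0 = x≉0 (*-cancelʳ y≉0 (trans xy≈0 (sym (zeroˡ y))))

  ^-nonzero : ∀ {x} n → x ≉ 0# → x ^ n ≉ 0#
  ^-nonzero zero    x≉0 = 1≉0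
  ^-nonzero (suc n) x≉0 = *-nonzero x≉0 (^-nonzero n x≉0)

  ^≈0⇒≈0 : ∀ {x} n .{{_ : NonZero n}} → x ^ n ≈ 0# → x ≈ 0#
  ^≈0⇒≈0 {x} n xⁿ≈0 with x ≟ 0#
  ... | yes x≈0 = x≈0
  ... | no  x≉0 = contradiction xⁿ≈0 (^-nonzero n x≉0)

  ^≈0⇔≈0 : ∀ n .{{_ : NonZero n}} {x} → x ^ n ≈ 0# ⇔ x ≈ 0#
  ^≈0⇔≈0 n = mk⇔ (^≈0⇒≈0 n) (λ x≈0 → trans (^-congˡ n x≈0) (0^n≈0 n))

  ^-root-nonzero : ∀ n .{{_ : NonZero n}} {x c} → x ^ n ≈ c → c ≉ 0# → x ≉ 0#
  ^-root-nonzero n xⁿ≈c c≉0 x≈0 = c≉0 (trans (sym xⁿ≈c) (Equivalence.from (^≈0⇔≈0 n) x≈0))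

  inv : ∀ x → x ≉ 0# → Carrier
  inv x x≉0 = proj₁ (inverse x x≉0)

  *-inverseʳ : ∀ x (x≉0 : x ≉ 0#) → x * inv x x≉0 ≈ 1#
  *-inverseʳ x x≉0 = proj₂ (inverse x x≉0)

  *-inverseˡ : ∀ x (x≉0 : x ≉ 0#) → inv x x≉0 * x ≈ 1#
  *-inverseˡ x x≉0 = trans (*-comm _ _) (*-inverseʳ x x≉0)

  inv-nonzero : ∀ x (x≉0 : x ≉ 0#) → inv x x≉0 ≉ 0#
  inv-nonzero x x≉0 w≈0 = 1≉0 (trans (sym (*-inverseʳ x x≉0)) (trans (*-congˡ w≈0) (zeroʳ x)))

  *-inverse-cancelˡ : ∀ x (x≉0 : x ≉ 0#) y → inv x x≉0 * (x * y) ≈ y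
  *-inverse-cancelˡ x x≉0 y = trans (sym (*-assoc _ _ _)) (trans (*-congʳ (*-inverseˡ x x≉0)) (*-identityˡ y))

  *-inverse-cancelʳ : ∀ x (x≉0 : x ≉ 0#) y → x * (inv x x≉0 * y) ≈ y
  *-inverse-cancelʳ x x≉0 y = trans (sym (*-assoc _ _ _)) (trans (*-congʳ (*-inverseʳ x x≉0)) (*-identityˡ y))

  ≟-cong : ∀ {x y u v} → x ≈ u → y ≈ v → does (x ≟ y) ≡ does (u ≟ v)
  ≟-cong x≈u y≈v = does-⇔ (mk⇔ (λ x≈y → trans (sym x≈u) (trans x≈y y≈v))
                                (λ u≈v → trans x≈u (trans u≈v (sym y≈v)))) (_ ≟ _) (_ ≟ _)

  *-inverse-move : ∀ {x y z} (z≉0 : z ≉ 0#) → x * z ≈ y ⇔ x ≈ y * inv z z≉0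
  *-inverse-move {x} {y} {z} z≉0 = mk⇔
    (λ xz≈y → *-cancelʳ z≉0 (trans xz≈y (sym (trans (*-assoc _ _ _)
      (trans (*-congˡ (*-inverseˡ z z≉0)) (*-identityʳ y))))))
    (λ x≈y/z → trans (*-congʳ x≈y/z) (trans (*-assoc _ _ _)
      (trans (*-congˡ (*-inverseˡ z z≉0)) (*-identityʳ y))))

  UniqueNonzero : ∀ {p} → (Carrier → Set p) → Set _
  UniqueNonzero P = Σ Carrier λ t₀ → t₀ ≉ 0# × P t₀ × (∀ {t} → t ≉ 0# → P t → t ≈ t₀)

  UniqueNonzero-map : ∀ {p q} {P : Carrier → Set p} {Q : Carrier → Set q} →
                      (∀ {t} → t ≉ 0# → P t ⇔ Q t) → UniqueNonzero P → UniqueNonzero Q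
  UniqueNonzero-map P⇔Q (t₀ , t₀≉0 , Pt₀ , unique) =
    t₀ , t₀≉0 , Equivalence.to (P⇔Q t₀≉0) Pt₀ ,
    λ t≉0 Qt → unique t≉0 (Equivalence.from (P⇔Q t≉0) Qt)

module FieldSum {c ℓ} (F : FiniteField c ℓ) {a r} (M : CommutativeMonoid a r) where
  open FiniteField F using (Carrier; _≈_; _≉_; _*_; *-congˡ; 0#; size; enum; enum-surj; enum-inj)
    renaming (sym to ≈-sym; trans to ≈-trans)
  open FieldAlgebra F using (inv; *-inverse-cancelˡ; *-inverse-cancelʳ)
  open CommutativeMonoid M renaming (Carrier to A; _≈_ to _≈ᴹ_) hiding (_≉_)
  open Sum M using (sum; sum-cong-≋; sum-permute; sum-replicate-zero; ∑-comm; ∑-distrib-+)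

  ∑F : (Carrier → A) → A
  ∑F T = sum (T ∘ enum)

  index : Carrier → Fin size
  index x = proj₁ (enum-surj x)

  enum-index : ∀ x → enum (index x) ≈ x
  enum-index x = proj₂ (enum-surj x)

  ∑F-cong : ∀ {T T′ : Carrier → A} → (∀ x → T x ≈ᴹ T′ x) → ∑F T ≈ᴹ ∑F T′
  ∑F-cong T≈T′ = sum-cong-≋ (T≈T′ ∘ enum)

  ∑F-comm : ∀ (h : Carrier → Carrier → A) →
            ∑F (λ x → ∑F (h x)) ≈ᴹ ∑F (λ y → ∑F (λ x → h x y))
  ∑F-comm h = ∑-comm (λ i j → h (enum i) (enum j))

  ∑F-distrib-∙ : ∀ (T T′ : Carrier → A) → ∑F (λ x → T x ∙ T′ x) ≈ᴹ ∑F T ∙ ∑F T′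
  ∑F-distrib-∙ T T′ = ∑-distrib-+ (T ∘ enum) (T′ ∘ enum)

  sum-zero : ∀ {n} {f : Fin n → A} → (∀ j → f j ≈ᴹ ε) → sum f ≈ᴹ ε
  sum-zero {n} f≈ε = trans (sum-cong-≋ f≈ε) (sum-replicate-zero n)

  ∑F-zero : ∀ {T : Carrier → A} → (∀ x → T x ≈ᴹ ε) → ∑F T ≈ᴹ ε
  ∑F-zero T≈ε = sum-zero (T≈ε ∘ enum)

  sum-single : ∀ {n} (f : Fin n → A) i → (∀ j → j ≢ i → f j ≈ᴹ ε) → sum f ≈ᴹ f i
  sum-single f zero    f≈ε = trans (∙-congˡ (sum-zero (λ j → f≈ε (suc j) λ ()))) (identityʳ _)
  sum-single f (suc i) f≈ε = trans (∙-cong (f≈ε zero λ ())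
    (sum-single (f ∘ suc) i (λ j j≢i → f≈ε (suc j) (j≢i ∘ Fin.suc-injective)))) (identityˡ _)

  ∑F-single : ∀ (T : Carrier → A) → T Preserves _≈_ ⟶ _≈ᴹ_ →
              ∀ x₀ → (∀ x → x ≉ x₀ → T x ≈ᴹ ε) → ∑F T ≈ᴹ T x₀
  ∑F-single T T-resp x₀ T≈ε = trans (sum-single (T ∘ enum) (index x₀) off) (T-resp (enum-index x₀))
    where
    off : ∀ i → i ≢ index x₀ → T (enum i) ≈ᴹ ε
    off i i≢ = T≈ε _ (λ e → i≢ (enum-inj (≈-trans e (≈-sym (enum-index x₀)))))

  ∑F-reindex : ∀ (φ ψ : Carrier → Carrier) →
               φ Preserves _≈_ ⟶ _≈_ → ψ Preserves _≈_ ⟶ _≈_ →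
               (∀ x → ψ (φ x) ≈ x) → (∀ y → φ (ψ y) ≈ y) →
               ∀ (T : Carrier → A) → T Preserves _≈_ ⟶ _≈ᴹ_ → ∑F (T ∘ φ) ≈ᴹ ∑F T
  ∑F-reindex φ ψ φ-resp ψ-resp ψφ≈id φψ≈id T T-resp = trans
    (sum-cong-≋ (λ i → T-resp (≈-sym (enum-index (φ (enum i))))))
    (sym (sum-permute (T ∘ enum) π))
    where
    π : Permutation′ size
    π = permutation (λ i → index (φ (enum i))) (λ j → index (ψ (enum j)))
      (λ j → enum-inj (≈-trans (enum-index _) (≈-trans (φ-resp (enum-index _)) (φψ≈id _))))
      (λ i → enum-inj (≈-trans (enum-index _) (≈-trans (ψ-resp (enum-index _)) (ψφ≈id _))))

  ∑F-*-invariant : ∀ {c} → c ≉ 0# → ∀ (T : Carrier → A) → T Preserves _≈_ ⟶ _≈ᴹ_ →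
                   ∑F (λ x → T (c * x)) ≈ᴹ ∑F T
  ∑F-*-invariant {c} c≉0 = ∑F-reindex (c *_) (inv c c≉0 *_) *-congˡ *-congˡ
    (*-inverse-cancelˡ c c≉0) (*-inverse-cancelʳ c c≉0)

m∣lcmAll : ∀ n (m : Fin n → ℕ) j → m j ∣ lcmAll n m
m∣lcmAll (suc n) m zero    = m∣lcm[m,n] (m zero) _
m∣lcmAll (suc n) m (suc j) = ∣-trans (m∣lcmAll n (m ∘ suc) j) (n∣lcm[m,n] (m zero) _)

gcd-nonZeroˡ : ∀ m n .{{_ : NonZero m}} → NonZero (gcd m n)
gcd-nonZeroˡ m n = ℕ.≢-nonZero (gcd[m,n]≢0 m n (inj₁ (ℕ.≢-nonZero⁻¹ m)))

𝟙 : Bool → ℕ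
𝟙 b = if b then 1 else 0

module Units {c ℓ} (F : FiniteField c ℓ) where
  open FiniteField F hiding (zero)
  open FieldAlgebra F
  open Sum ℕ.+-0-commutativeMonoid using (sum)
  open Sum *-commutativeMonoid using () renaming (sum to prod; ∑-distrib-+ to prod-distrib-*)
  module ∏F = FieldSum F *-commutativeMonoid
  open FieldSum F ℕ.+-0-commutativeMonoid

  nonzero? : Carrier → Bool
  nonzero? x = not (does (x ≟ 0#))

  sum-𝟙-not : ∀ {n} (b : Fin n → Bool) → sum (𝟙 ∘ not ∘ b) ℕ.+ sum (𝟙 ∘ b) ≡ n
  sum-𝟙-not {zero}  b = ≡.refl
  sum-𝟙-not {suc n} b with b zero | sum-𝟙-not (b ∘ suc)
  ... | true  | ih = ≡.trans (ℕ.+-suc _ _) (≡.cong suc ih)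
  ... | false | ih = ≡.cong suc ih

  count-nonzero : ∑F (𝟙 ∘ nonzero?) ≡ size ∸ 1
  count-nonzero = begin
    ∑F (𝟙 ∘ nonzero?)                       ≡⟨ ℕ.m+n∸n≡m _ 1 ⟨
    ∑F (𝟙 ∘ nonzero?) ℕ.+ 1 ∸ 1             ≡⟨ ≡.cong (λ z → ∑F (𝟙 ∘ nonzero?) ℕ.+ z ∸ 1) count-zero ⟨
    ∑F (𝟙 ∘ nonzero?) ℕ.+ ∑F (𝟙 ∘ zero?) ∸ 1 ≡⟨ ≡.cong (_∸ 1) (sum-𝟙-not (zero? ∘ enum)) ⟩
    size ∸ 1                                ∎
    where
    open ≡.≡-Reasoning
    zero? : Carrier → Bool
    zero? x = does (x ≟ 0#)
    count-zero : ∑F (𝟙 ∘ zero?) ≡ 1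
    count-zero = ≡.trans (∑F-single _ resp 0# off) (≡.cong 𝟙 (dec-true (0# ≟ 0#) refl))
      where
      resp : ∀ {x y} → x ≈ y → 𝟙 (zero? x) ≡ 𝟙 (zero? y)
      resp x≈y = ≡.cong 𝟙 (≟-cong x≈y refl)
      off : ∀ x → x ≉ 0# → 𝟙 (zero? x) ≡ 0
      off x x≉0 = ≡.cong 𝟙 (dec-false (x ≟ 0#) x≉0)

  prod-select : ∀ {n} (b : Fin n → Bool) y → prod (λ i → if b i then y else 1#) ≈ y ^ sum (𝟙 ∘ b)
  prod-select {zero}  b y = refl
  prod-select {suc n} b y with b zero
  ... | true  = *-congˡ (prod-select (b ∘ suc) y)
  ... | false = trans (*-identityˡ _) (prod-select (b ∘ suc) y)

  prod-nonzero : ∀ {n} (f : Fin n → Carrier) → (∀ i → f i ≉ 0#) → prod f ≉ 0#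
  prod-nonzero {zero}  f f≉0 = 1≉0
  prod-nonzero {suc n} f f≉0 = *-nonzero (f≉0 zero) (prod-nonzero (f ∘ suc) (f≉0 ∘ suc))

  0↦1 : Carrier → Carrier
  0↦1 x = if does (x ≟ 0#) then 1# else x

  0↦1-cong : ∀ {x y} → x ≈ y → 0↦1 x ≈ 0↦1 y
  0↦1-cong {x} {y} x≈y with x ≟ 0# | y ≟ 0#
  ... | yes _   | yes _   = refl
  ... | yes x≈0 | no  y≉0 = contradiction (trans (sym x≈y) x≈0) y≉0
  ... | no  x≉0 | yes y≈0 = contradiction (trans x≈y y≈0) x≉0
  ... | no  _   | no  _   = x≈y

  0↦1-nonzero : ∀ x → 0↦1 x ≉ 0#
  0↦1-nonzero x with x ≟ 0#
  ... | yes _   = 1≉0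
  ... | no  x≉0 = x≉0

  0↦1-* : ∀ {y} → y ≉ 0# → ∀ x → 0↦1 (y * x) ≈ (if nonzero? x then y else 1#) * 0↦1 x
  0↦1-* {y} y≉0 x with x ≟ 0# | (y * x) ≟ 0#
  ... | yes _   | yes _    = sym (*-identityˡ 1#)
  ... | yes x≈0 | no  yx≉0 = contradiction (trans (*-congˡ x≈0) (zeroʳ y)) yx≉0
  ... | no  x≉0 | yes yx≈0 = contradiction yx≈0 (*-nonzero y≉0 x≉0)
  ... | no  _   | no  _    = refl

  -- Multiplication by y permutes F, so it fixes ∏ₓ 0↦1 x, while it multiplies each of the
  -- q - 1 nonzero factors by y.
  fermat : ∀ {y} → y ≉ 0# → y ^ (size ∸ 1) ≈ 1#
  fermat {y} y≉0 = *-cancelʳ (prod-nonzero (0↦1 ∘ enum) (0↦1-nonzero ∘ enum)) (begin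
    y ^ (size ∸ 1) * P                                   ≡⟨ ≡.cong (λ e → y ^ e * P) count-nonzero ⟨
    y ^ ∑F (𝟙 ∘ nonzero?) * P
      ≈⟨ *-congʳ (prod-select (nonzero? ∘ enum) y) ⟨
    ∏F.∑F (λ x → if nonzero? x then y else 1#) * P       ≈⟨ prod-distrib-* _ (0↦1 ∘ enum) ⟨
    ∏F.∑F (λ x → (if nonzero? x then y else 1#) * 0↦1 x) ≈⟨ ∏F.∑F-cong (λ x → sym (0↦1-* y≉0 x)) ⟩
    ∏F.∑F (λ x → 0↦1 (y * x))
      ≈⟨ ∏F.∑F-*-invariant y≉0 0↦1 0↦1-cong ⟩
    P                                                    ≈⟨ *-identityˡ P ⟨
    1# * P                                               ∎)
    where
    open ≈-Reasoning
    P : Carrier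
    P = ∏F.∑F 0↦1

  q≡2+[q-2] : size ≡ 2 ℕ.+ (size ∸ 2)
  q≡2+[q-2] = at-least-two (index 0#) (index 1#) 0≢1
    where
    0≢1 : index 0# ≢ index 1#
    0≢1 eq = 0≉1 (trans (sym (enum-index 0#)) (trans (reflexive (≡.cong enum eq)) (enum-index 1#)))
    at-least-two : ∀ {n} (i j : Fin n) → i ≢ j → n ≡ 2 ℕ.+ (n ∸ 2)
    at-least-two {suc zero}    zero zero i≢j = contradiction ≡.refl i≢j
    at-least-two {suc (suc n)} _    _    _   = ≡.refl

  q-1≡suc[q-2] : size ∸ 1 ≡ suc (size ∸ 2)
  q-1≡suc[q-2] = ≡.cong (_∸ 1) q≡2+[q-2]

  q≡suc[q-1] : size ≡ suc (size ∸ 1)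
  q≡suc[q-1] = ≡.trans q≡2+[q-2] (≡.cong suc (≡.sym q-1≡suc[q-2]))

  ^-periodic : ∀ {y} → y ≉ 0# → ∀ v → y ^ (v ℕ.* (size ∸ 1)) ≈ 1#
  ^-periodic {y} y≉0 v = begin
    y ^ (v ℕ.* (size ∸ 1))  ≡⟨ ≡.cong (y ^_) (ℕ.*-comm v (size ∸ 1)) ⟩
    y ^ ((size ∸ 1) ℕ.* v)  ≈⟨ ^-assocʳ y (size ∸ 1) v ⟨
    (y ^ (size ∸ 1)) ^ v    ≈⟨ ^-congˡ v (fermat y≉0) ⟩
    1# ^ v                  ≈⟨ 1^n≈1 v ⟩
    1#                      ∎
    where open ≈-Reasoning

  -- Bézout gives a·u ≡ ± gcd a (q - 1) modulo q - 1; exponents act modulo q - 1 by Fermat, and in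
  -- the negative case g ^ (q - 2) inverts g = (y ^ a) ^ u.
  ^-gcd-as-power : ∀ a → ∃ λ u → ∀ {y} → y ≉ 0# → (y ^ a) ^ u ≈ y ^ gcd a (size ∸ 1)
  ^-gcd-as-power a with Bézout.identity (gcd-GCD a (size ∸ 1))
  ... | Bézout.+- u v eq = u , λ {y} y≉0 → begin
    (y ^ a) ^ u                        ≈⟨ ^-assocʳ y a u ⟩
    y ^ (a ℕ.* u)                      ≡⟨ ≡.cong (y ^_) (≡.trans (ℕ.*-comm a u) (≡.sym eq)) ⟩
    y ^ (d ℕ.+ v ℕ.* (size ∸ 1))       ≈⟨ ^-homo-* y d _ ⟩
    y ^ d * y ^ (v ℕ.* (size ∸ 1))     ≈⟨ *-congˡ (^-periodic y≉0 v) ⟩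
    y ^ d * 1#                         ≈⟨ *-identityʳ _ ⟩
    y ^ d                              ∎
    where
    open ≈-Reasoning
    d : ℕ
    d = gcd a (size ∸ 1)
  ... | Bézout.-+ u v eq = u ℕ.* (size ∸ 2) , λ y≉0 → solution y≉0
    where
    open ≈-Reasoning
    d : ℕ
    d = gcd a (size ∸ 1)
    solution : ∀ {y} → y ≉ 0# → (y ^ a) ^ (u ℕ.* (size ∸ 2)) ≈ y ^ d
    solution {y} y≉0 = begin
      (y ^ a) ^ (u ℕ.* (size ∸ 2))  ≈⟨ ^-assocʳ (y ^ a) u (size ∸ 2) ⟨
      g ^ (size ∸ 2)                ≈⟨ *-cancelʳ g≉0 (trans g^[q-2]-inverse (sym y^d-inverse)) ⟩
      y ^ d                         ∎
      where
      g : Carrier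
      g = (y ^ a) ^ u
      g≉0 : g ≉ 0#
      g≉0 = ^-nonzero u (^-nonzero a y≉0)
      g^[q-2]-inverse : g ^ (size ∸ 2) * g ≈ 1#
      g^[q-2]-inverse = begin
        g ^ (size ∸ 2) * g  ≈⟨ *-comm _ g ⟩
        g ^ suc (size ∸ 2)  ≡⟨ ≡.cong (g ^_) q-1≡suc[q-2] ⟨
        g ^ (size ∸ 1)      ≈⟨ fermat g≉0 ⟩
        1#                  ∎
      y^d-inverse : y ^ d * g ≈ 1#
      y^d-inverse = begin
        y ^ d * g              ≈⟨ *-congˡ (^-assocʳ y a u) ⟩
        y ^ d * y ^ (a ℕ.* u)  ≈⟨ ^-homo-* y d (a ℕ.* u) ⟨
        y ^ (d ℕ.+ a ℕ.* u)    ≡⟨ ≡.cong (λ e → y ^ (d ℕ.+ e)) (ℕ.*-comm a u) ⟩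
        y ^ (d ℕ.+ u ℕ.* a)    ≡⟨ ≡.cong (y ^_) eq ⟩
        y ^ (v ℕ.* (size ∸ 1)) ≈⟨ ^-periodic y≉0 v ⟩
        1#                     ∎

  unique-root : ∀ {e C} → gcd e (size ∸ 1) ≡ 1 → C ≉ 0# → UniqueNonzero (λ t → t ^ e ≈ C)
  unique-root {e} {C} coprime C≉0 = C ^ u , ^-nonzero u C≉0 , root , unique
    where
    u : ℕ
    u = proj₁ (^-gcd-as-power e)
    ^e^u≈id : ∀ {y} → y ≉ 0# → (y ^ e) ^ u ≈ y
    ^e^u≈id {y} y≉0 = trans (proj₂ (^-gcd-as-power e) y≉0)
      (trans (reflexive (≡.cong (y ^_) coprime)) (*-identityʳ y))
    root : (C ^ u) ^ e ≈ C
    root = trans (^-comm C u e) (^e^u≈id C≉0)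
    unique : ∀ {t} → t ≉ 0# → t ^ e ≈ C → t ≈ C ^ u
    unique t≉0 tᵉ≈C = trans (sym (^e^u≈id t≉0)) (^-congˡ u tᵉ≈C)

  balancing-unique-≤ : ∀ {K S A B} → K ≤ S → gcd (S ∸ K) (size ∸ 1) ≡ 1 → A ≉ 0# → B ≉ 0# →
                       UniqueNonzero (λ t → t ^ K * A ≈ t ^ S * B)
  balancing-unique-≤ {K} {S} {A} {B} K≤S coprime A≉0 B≉0 =
    UniqueNonzero-map balances⇔root (unique-root {S ∸ K} coprime (*-nonzero A≉0 (inv-nonzero B B≉0)))
    where
    e : ℕ
    e = S ∸ K
    split : ∀ t → t ^ S * B ≈ t ^ K * (t ^ e * B)
    split t = trans (*-congʳ (trans (reflexive (≡.cong (t ^_) (≡.sym (ℕ.m+[n∸m]≡n K≤S))))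
      (^-homo-* t K e))) (*-assoc _ _ _)
    balances⇔root : ∀ {t} → t ≉ 0# → t ^ e ≈ A * inv B B≉0 ⇔ t ^ K * A ≈ t ^ S * B
    balances⇔root {t} t≉0 = mk⇔
      (λ root → trans (*-congˡ (sym (Equivalence.from (*-inverse-move B≉0) root))) (sym (split t)))
      (λ balanced → Equivalence.to (*-inverse-move B≉0)
        (sym (*-cancelˡ (^-nonzero K t≉0) (trans balanced (split t)))))

  balancing-unique : ∀ K S {A B} → gcd ℕ.∣ S - K ∣ (size ∸ 1) ≡ 1 → A ≉ 0# → B ≉ 0# →
                     UniqueNonzero (λ t → t ^ K * A ≈ t ^ S * B)
  balancing-unique K S coprime A≉0 B≉0 with ℕ.≤-total K S
  ... | inj₁ K≤S = balancing-unique-≤ K≤S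
    (≡.subst (λ e → gcd e (size ∸ 1) ≡ 1) (ℕ.m≤n⇒∣n-m∣≡n∸m K≤S) coprime) A≉0 B≉0
  ... | inj₂ S≤K = UniqueNonzero-map (λ _ → mk⇔ sym sym) (balancing-unique-≤ S≤K
    (≡.subst (λ e → gcd e (size ∸ 1) ≡ 1) (ℕ.m≤n⇒∣m-n∣≡n∸m S≤K) coprime) B≉0 A≉0)

  module _ (m : ℕ) .{{_ : NonZero m}} where
    private
      d m/d u : ℕ
      d   = gcd m (size ∸ 1)
      m/d = quotient (gcd[m,n]∣m m (size ∸ 1))
      u   = proj₁ (^-gcd-as-power m)
      instance
        d-nonZero : NonZero d
        d-nonZero = gcd-nonZeroˡ m (size ∸ 1)
      ^m≈[^m/d]^d : ∀ y → y ^ m ≈ (y ^ m/d) ^ d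
      ^m≈[^m/d]^d y = trans (reflexive (≡.cong (y ^_) (_∣_.equality (gcd[m,n]∣m m (size ∸ 1)))))
                            (sym (^-assocʳ y m/d d))
      [^m]^u≈^d : ∀ {y} → y ≉ 0# → (y ^ m) ^ u ≈ y ^ d
      [^m]^u≈^d = proj₂ (^-gcd-as-power m)

    ^≈1⇔^gcd≈1 : ∀ {y} → y ^ m ≈ 1# ⇔ y ^ gcd m (size ∸ 1) ≈ 1#
    ^≈1⇔^gcd≈1 {y} = mk⇔
      (λ yᵐ≈1 → trans (sym ([^m]^u≈^d (^-root-nonzero m yᵐ≈1 1≉0)))
                       (trans (^-congˡ u yᵐ≈1) (1^n≈1 u)))
      (λ yᵈ≈1 → trans (^m≈[^m/d]^d y) (trans (^-comm y m/d d) (trans (^-congˡ m/d yᵈ≈1) (1^n≈1 m/d))))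

    ^-root⇔^gcd-root : ∀ {c} → c ≉ 0# →
                       (∃ λ x → x ^ m ≈ c) ⇔ (∃ λ w → w ^ gcd m (size ∸ 1) ≈ c)
    ^-root⇔^gcd-root c≉0 = mk⇔
      (λ (x , xᵐ≈c) → x ^ m/d , trans (sym (^m≈[^m/d]^d x)) xᵐ≈c)
      (λ (w , wᵈ≈c) → w ^ u ,
        trans (^-comm w u m) (trans ([^m]^u≈^d (^-root-nonzero d wᵈ≈c c≉0)) wᵈ≈c))

module BigOperators {c ℓ} (F : FiniteField c ℓ) where
  open FiniteField F hiding (zero)
  open FieldAlgebra F

  ∑-cong : ∀ n {f g : Fin n → Carrier} → (∀ j → f j ≈ g j) → ∑ F n f ≈ ∑ F n g
  ∑-cong zero    f≈g = refl
  ∑-cong (suc n) f≈g = +-cong (f≈g zero) (∑-cong n (f≈g ∘ suc))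

  ∏-cong : ∀ n {f g : Fin n → Carrier} → (∀ j → f j ≈ g j) → ∏ F n f ≈ ∏ F n g
  ∏-cong zero    f≈g = refl
  ∏-cong (suc n) f≈g = *-cong (f≈g zero) (∏-cong n (f≈g ∘ suc))

  *-distribˡ-∑ : ∀ n x (f : Fin n → Carrier) → ∑ F n (λ j → x * f j) ≈ x * ∑ F n f
  *-distribˡ-∑ zero    x f = sym (zeroʳ x)
  *-distribˡ-∑ (suc n) x f = trans (+-congˡ (*-distribˡ-∑ n x (f ∘ suc))) (sym (distribˡ x _ _))

  ∏-distrib-* : ∀ n (f g : Fin n → Carrier) → ∏ F n (λ j → f j * g j) ≈ ∏ F n f * ∏ F n g
  ∏-distrib-* zero    f g = sym (*-identityˡ 1#)
  ∏-distrib-* (suc n) f g = trans (*-congˡ (∏-distrib-* n (f ∘ suc) (g ∘ suc)))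
    (interchange (f zero) (g zero) _ _)

  ∏-^ : ∀ n x (e : Fin n → ℕ) → ∏ F n (λ j → x ^ e j) ≈ x ^ ∑ℕ n e
  ∏-^ zero    x e = refl
  ∏-^ (suc n) x e = trans (*-congˡ (∏-^ n x (e ∘ suc))) (sym (^-homo-* x (e zero) _))

  ∏-zero : ∀ n (f : Fin n → Carrier) j → f j ≈ 0# → ∏ F n f ≈ 0#
  ∏-zero (suc n) f zero    fⱼ≈0 = trans (*-congʳ fⱼ≈0) (zeroˡ _)
  ∏-zero (suc n) f (suc j) fⱼ≈0 = trans (*-congˡ (∏-zero n (f ∘ suc) j fⱼ≈0)) (zeroʳ _)

  ∏-nonzero : ∀ n (f : Fin n → Carrier) → (∀ j → f j ≉ 0#) → ∏ F n f ≉ 0#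
  ∏-nonzero zero    f f≉0 = 1≉0
  ∏-nonzero (suc n) f f≉0 = *-nonzero (f≉0 zero) (∏-nonzero n (f ∘ suc) (f≉0 ∘ suc))

module Counting {c ℓ} (F : FiniteField c ℓ) where
  open FiniteField F hiding (zero)
  open FieldAlgebra F
  open Units F
  open FieldSum F ℕ.+-0-commutativeMonoid
  open SemiringSum ℕ.+-*-semiring using (*-distribˡ-sum)
  open Sum ℕ.+-0-commutativeMonoid using (sum; sum-cong-≋)
  open ≡.≡-Reasoning

  Equidistributed : (Carrier → Carrier) → (Carrier → Carrier) → Set _
  Equidistributed f g = ∀ T → T Preserves _≈_ ⟶ _≡_ → ∑F (T ∘ f) ≡ ∑F (T ∘ g)

  ∑F-distribˡ-* : ∀ n (T : Carrier → ℕ) → ∑F (λ x → n ℕ.* T x) ≡ n ℕ.* ∑F T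
  ∑F-distribˡ-* n T = ≡.sym (*-distribˡ-sum n (T ∘ enum))

  fiber : (Carrier → Carrier) → Carrier → ℕ
  fiber f c = ∑F (λ y → 𝟙 (does (f y ≟ c)))

  ∑F-by-fibers : ∀ f T → T Preserves _≈_ ⟶ _≡_ → ∑F (T ∘ f) ≡ ∑F (λ c → T c ℕ.* fiber f c)
  ∑F-by-fibers f T T-resp = begin
    ∑F (T ∘ f)                            ≡⟨ ∑F-cong (λ y → ≡.sym (at-image y)) ⟩
    ∑F (λ y → ∑F (λ c → T c ℕ.* [ y ↦ c ])) ≡⟨ ∑F-comm (λ y c → T c ℕ.* [ y ↦ c ]) ⟩
    ∑F (λ c → ∑F (λ y → T c ℕ.* [ y ↦ c ])) ≡⟨ ∑F-cong (λ c → ∑F-distribˡ-* (T c) [_↦ c ]) ⟩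
    ∑F (λ c → T c ℕ.* fiber f c)          ∎
    where
    [_↦_] : Carrier → Carrier → ℕ
    [ y ↦ c ] = 𝟙 (does (f y ≟ c))
    at-image : ∀ y → ∑F (λ c → T c ℕ.* [ y ↦ c ]) ≡ T (f y)
    at-image y = ≡.trans (∑F-single _ resp (f y) off) (≡.trans
      (≡.cong (λ b → T (f y) ℕ.* 𝟙 b) (dec-true (f y ≟ f y) refl)) (ℕ.*-identityʳ _))
      where
      resp : ∀ {c c′} → c ≈ c′ → T c ℕ.* [ y ↦ c ] ≡ T c′ ℕ.* [ y ↦ c′ ]
      resp c≈c′ = ≡.cong₂ ℕ._*_ (T-resp c≈c′) (≡.cong 𝟙 (≟-cong refl c≈c′))
      off : ∀ c → c ≉ f y → T c ℕ.* [ y ↦ c ] ≡ 0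
      off c c≉fy = ≡.trans (≡.cong (λ b → T c ℕ.* 𝟙 b) (dec-false (f y ≟ c) (c≉fy ∘ sym))) (ℕ.*-zeroʳ (T c))

  equal-fibers⇒equidistributed : ∀ {f g} → (∀ c → fiber f c ≡ fiber g c) → Equidistributed f g
  equal-fibers⇒equidistributed {f} {g} same T T-resp = begin
    ∑F (T ∘ f)                    ≡⟨ ∑F-by-fibers f T T-resp ⟩
    ∑F (λ c → T c ℕ.* fiber f c)  ≡⟨ ∑F-cong (λ c → ≡.cong (T c ℕ.*_) (same c)) ⟩
    ∑F (λ c → T c ℕ.* fiber g c)  ≡⟨ ∑F-by-fibers g T T-resp ⟨
    ∑F (T ∘ g)                    ∎

  fiber-cong : ∀ f g {c d} → (∀ y → f y ≈ c ⇔ g y ≈ d) → fiber f c ≡ fiber g d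
  fiber-cong f g f⇔g = ∑F-cong (λ y → ≡.cong 𝟙 (does-⇔ (f⇔g y) (_ ≟ _) (_ ≟ _)))

  fiber-^-nonzero : ∀ e {z} → z ≉ 0# → fiber (_^ e) (z ^ e) ≡ fiber (_^ e) 1#
  fiber-^-nonzero e {z} z≉0 = begin
    fiber (_^ e) (z ^ e)                  ≡⟨ fiber-cong (_^ e) (λ y → (w * y) ^ e) shift ⟩
    fiber (λ y → (w * y) ^ e) 1#          ≡⟨ ∑F-*-invariant (inv-nonzero z z≉0) _ resp ⟩
    fiber (_^ e) 1#                       ∎
    where
    w = inv z z≉0
    wᵉzᵉ≈1 : w ^ e * z ^ e ≈ 1#
    wᵉzᵉ≈1 = trans (sym (^-distrib-* w z e)) (trans (^-congˡ e (*-inverseˡ z z≉0)) (1^n≈1 e))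
    shift : ∀ y → y ^ e ≈ z ^ e ⇔ (w * y) ^ e ≈ 1#
    shift y = mk⇔
      (λ yᵉ≈zᵉ → trans (^-distrib-* w y e) (trans (*-congˡ yᵉ≈zᵉ) wᵉzᵉ≈1))
      (λ [wy]ᵉ≈1 → *-cancelˡ (^-nonzero e (inv-nonzero z z≉0))
        (trans (sym (^-distrib-* w y e)) (trans [wy]ᵉ≈1 (sym wᵉzᵉ≈1))))
    resp : ∀ {x y} → x ≈ y → 𝟙 (does ((x ^ e) ≟ 1#)) ≡ 𝟙 (does ((y ^ e) ≟ 1#))
    resp x≈y = ≡.cong 𝟙 (≟-cong (^-congˡ e x≈y) refl)

  fiber-empty : ∀ {f c} → (∀ y → f y ≉ c) → fiber f c ≡ 0
  fiber-empty {f} {c} no-root = ∑F-zero (λ y → ≡.cong 𝟙 (dec-false (f y ≟ c) (no-root y)))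

  fiber-congʳ : ∀ f {c c′} → c ≈ c′ → fiber f c ≡ fiber f c′
  fiber-congʳ f c≈c′ = ∑F-cong (λ y → ≡.cong 𝟙 (≟-cong {f y} refl c≈c′))

  -- Both maps send only 0 to 0; a nonzero c is an m-th power iff it is a d-th power, and then
  -- both fibres over c are translates of the equal kernels {y ^ m ≈ 1} and {y ^ d ≈ 1}.
  ^-equidistributed-gcd : ∀ m .{{_ : NonZero m}} → Equidistributed (_^ m) (_^ gcd m (size ∸ 1))
  ^-equidistributed-gcd m = equal-fibers⇒equidistributed {_^ m} {_^ d} same-fiber
    where
    d : ℕ
    d = gcd m (size ∸ 1)
    instance
      d-nonZero : NonZero d
      d-nonZero = gcd-nonZeroˡ m (size ∸ 1)
    through-zero : ∀ p q .{{_ : NonZero p}} .{{_ : NonZero q}} {c y} → c ≈ 0# → y ^ p ≈ c → y ^ q ≈ c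
    through-zero p q c≈0 yᵖ≈c =
      trans (Equivalence.from (^≈0⇔≈0 q) (Equivalence.to (^≈0⇔≈0 p) (trans yᵖ≈c c≈0))) (sym c≈0)
    same-fiber : ∀ c → fiber (_^ m) c ≡ fiber (_^ d) c
    same-fiber c with c ≟ 0#
    ... | yes c≈0 = fiber-cong (_^ m) (_^ d) (λ y → mk⇔ (through-zero m d c≈0) (through-zero d m c≈0))
    ... | no  c≉0 with Fin.any? (λ i → (enum i ^ m) ≟ c)
    ...   | yes (i , zᵐ≈c) = begin
      fiber (_^ m) c          ≡⟨ fiber-congʳ (_^ m) (sym zᵐ≈c) ⟩
      fiber (_^ m) (z ^ m)    ≡⟨ fiber-^-nonzero m (^-root-nonzero m zᵐ≈c c≉0) ⟩
      fiber (_^ m) 1#         ≡⟨ fiber-cong (_^ m) (_^ d) (λ _ → ^≈1⇔^gcd≈1 m) ⟩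
      fiber (_^ d) 1#         ≡⟨ fiber-^-nonzero d (^-root-nonzero d wᵈ≈c c≉0) ⟨
      fiber (_^ d) (w ^ d)    ≡⟨ fiber-congʳ (_^ d) wᵈ≈c ⟩
      fiber (_^ d) c          ∎
      where
      z w : Carrier
      z = enum i
      w = proj₁ (Equivalence.to (^-root⇔^gcd-root m c≉0) (z , zᵐ≈c))
      wᵈ≈c : w ^ d ≈ c
      wᵈ≈c = proj₂ (Equivalence.to (^-root⇔^gcd-root m c≉0) (z , zᵐ≈c))
    ...   | no  no-root = ≡.trans (fiber-empty no-root-m) (≡.sym (fiber-empty no-root-d))
      where
      no-root-m : ∀ y → y ^ m ≉ c
      no-root-m y yᵐ≈c = no-root (index y , trans (^-congˡ m (enum-index y)) yᵐ≈c)
      no-root-d : ∀ y → y ^ d ≉ c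
      no-root-d y yᵈ≈c = let x , xᵐ≈c = Equivalence.from (^-root⇔^gcd-root m c≉0) (y , yᵈ≈c)
                         in no-root-m x xᵐ≈c

  *-equidistributed : ∀ {c} → c ≉ 0# → Equidistributed (c *_) id
  *-equidistributed c≉0 = ∑F-*-invariant c≉0

  Respectsⁿ : ∀ {b} {B : Set b} n → ((Fin n → Carrier) → B) → Set _
  Respectsⁿ n w = w Preserves Pointwise _≈_ {n} ⟶ _≡_

  ∑Fⁿ : ∀ n → ((Fin n → Carrier) → ℕ) → ℕ
  ∑Fⁿ zero    w = w []
  ∑Fⁿ (suc n) w = ∑F (λ x → ∑Fⁿ n (λ xs → w (x ∷ xs)))

  ∑Fⁿ-cong : ∀ n {w w′ : (Fin n → Carrier) → ℕ} →
             (∀ xs → w xs ≡ w′ xs) → ∑Fⁿ n w ≡ ∑Fⁿ n w′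
  ∑Fⁿ-cong zero    w≡w′ = w≡w′ []
  ∑Fⁿ-cong (suc n) w≡w′ = ∑F-cong (λ x → ∑Fⁿ-cong n (λ xs → w≡w′ (x ∷ xs)))

  ∑Fⁿ-distrib-+ : ∀ n (w w′ : (Fin n → Carrier) → ℕ) →
                  ∑Fⁿ n (λ xs → w xs ℕ.+ w′ xs) ≡ ∑Fⁿ n w ℕ.+ ∑Fⁿ n w′
  ∑Fⁿ-distrib-+ zero    w w′ = ≡.refl
  ∑Fⁿ-distrib-+ (suc n) w w′ = ≡.trans
    (∑F-cong (λ x → ∑Fⁿ-distrib-+ n (w ∘ (x ∷_)) (w′ ∘ (x ∷_))))
    (∑F-distrib-∙ (λ x → ∑Fⁿ n (w ∘ (x ∷_))) (λ x → ∑Fⁿ n (w′ ∘ (x ∷_))))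

  ∑Fⁿ-distribˡ-* : ∀ n k (w : (Fin n → Carrier) → ℕ) →
                   ∑Fⁿ n (λ xs → k ℕ.* w xs) ≡ k ℕ.* ∑Fⁿ n w
  ∑Fⁿ-distribˡ-* zero    k w = ≡.refl
  ∑Fⁿ-distribˡ-* (suc n) k w = ≡.trans (∑F-cong (λ x → ∑Fⁿ-distribˡ-* n k (w ∘ (x ∷_))))
    (∑F-distribˡ-* k (λ x → ∑Fⁿ n (w ∘ (x ∷_))))

  ∑Fⁿ-∑F-comm : ∀ n (h : Carrier → (Fin n → Carrier) → ℕ) →
                ∑Fⁿ n (λ xs → ∑F (λ t → h t xs)) ≡ ∑F (λ t → ∑Fⁿ n (h t))
  ∑Fⁿ-∑F-comm zero    h = ≡.refl
  ∑Fⁿ-∑F-comm (suc n) h = ≡.trans (∑F-cong (λ x → ∑Fⁿ-∑F-comm n (λ t xs → h t (x ∷ xs))))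
                                  (∑F-comm (λ x t → ∑Fⁿ n (λ xs → h t (x ∷ xs))))

  ∑Fⁿ-equidistributed : ∀ n (f g : Fin n → Carrier → Carrier) → (∀ j → Equidistributed (f j) (g j)) →
                        ∀ w → Respectsⁿ n w →
                        ∑Fⁿ n (λ xs → w (λ j → f j (xs j))) ≡ ∑Fⁿ n (λ xs → w (λ j → g j (xs j)))
  ∑Fⁿ-equidistributed zero    f g f~g w w-resp = w-resp (λ ())
  ∑Fⁿ-equidistributed (suc n) f g f~g w w-resp = begin
    ∑F (λ x → ∑Fⁿ n (λ xs → w (λ j → f j ((x ∷ xs) j))))
      ≡⟨ ∑F-cong (λ x → ∑Fⁿ-cong n (λ xs → w-resp (head f x xs))) ⟩
    ∑F (λ x → ∑Fⁿ n (λ xs → w (f zero x ∷ λ j → f (suc j) (xs j))))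
      ≡⟨ ∑F-cong (λ x → ∑Fⁿ-equidistributed n (f ∘ suc) (g ∘ suc) (f~g ∘ suc)
                          (w ∘ (f zero x ∷_)) (w-resp ∘ cons-resp refl)) ⟩
    ∑F (λ x → T (f zero x))
      ≡⟨ f~g zero T (λ x≈y → ∑Fⁿ-cong n (λ xs → w-resp (cons-resp x≈y (λ _ → refl)))) ⟩
    ∑F (λ x → T (g zero x))
      ≡⟨ ∑F-cong (λ x → ∑Fⁿ-cong n (λ xs → w-resp (head g x xs))) ⟨
    ∑F (λ x → ∑Fⁿ n (λ xs → w (λ j → g j ((x ∷ xs) j))))
      ∎
    where
    T : Carrier → ℕ
    T y = ∑Fⁿ n (λ xs → w (y ∷ λ j → g (suc j) (xs j)))
    cons-resp : ∀ {x y} {xs ys : Fin n → Carrier} →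
                x ≈ y → Pointwise _≈_ xs ys → Pointwise _≈_ (x ∷ xs) (y ∷ ys)
    cons-resp x≈y xs≈ys zero    = x≈y
    cons-resp x≈y xs≈ys (suc j) = xs≈ys j
    head : ∀ (h : Fin (suc n) → Carrier → Carrier) x xs →
           Pointwise _≈_ (λ j → h j ((x ∷ xs) j)) (h zero x ∷ λ j → h (suc j) (xs j))
    head h x xs zero    = refl
    head h x xs (suc j) = refl

  count : ∀ n → ((Fin n → Carrier) → Bool) → ℕ
  count n P = ∑Fⁿ n (𝟙 ∘ P)

  sum-map-allFin : ∀ k (g : Fin k → ℕ) → List.sum (map g (allFin k)) ≡ sum g
  sum-map-allFin k g = ≡.trans (≡.cong List.sum (List.map-tabulate id g)) (sum-tabulate k g)
    where
    sum-tabulate : ∀ k (g : Fin k → ℕ) → List.sum (tabulate g) ≡ sum g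
    sum-tabulate zero    g = ≡.refl
    sum-tabulate (suc k) g = ≡.cong (g zero ℕ.+_) (sum-tabulate k (g ∘ suc))

  countPts-cong : ∀ n {t t′ : (Fin n → Carrier) → Bool} → (∀ xs → t xs ≡ t′ xs) →
                  countPts F n t ≡ countPts F n t′
  countPts-cong zero    t≡t′ = ≡.cong 𝟙 (t≡t′ _)
  countPts-cong (suc n) t≡t′ =
    ≡.cong List.sum (List.map-cong (λ i → countPts-cong n (λ xs → t≡t′ _)) (allFin size))

  countPts≡count : ∀ n (t : (Fin n → Carrier) → Bool) → Respectsⁿ n t → countPts F n t ≡ count n t
  countPts≡count zero    t t-resp = ≡.cong 𝟙 (t-resp (λ ()))
  countPts≡count (suc n) t t-resp = ≡.trans (sum-map-allFin size _) (sum-cong-≋ (λ i → ≡.trans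
    (countPts-cong n (λ xs → t-resp λ { zero → refl ; (suc j) → refl }))
    (countPts≡count n (t ∘ (enum i ∷_)) (λ xs≈ys → t-resp λ { zero → refl ; (suc j) → xs≈ys j }))))

  𝟙-∧ : ∀ a b → 𝟙 (a ∧ b) ≡ 𝟙 a ℕ.* 𝟙 b
  𝟙-∧ true  b = ≡.sym (ℕ.+-identityʳ (𝟙 b))
  𝟙-∧ false b = ≡.refl

  𝟙-split : ∀ a b → 𝟙 a ≡ 𝟙 (a ∧ b) ℕ.+ 𝟙 (a ∧ not b)
  𝟙-split true  true  = ≡.refl
  𝟙-split true  false = ≡.refl
  𝟙-split false b     = ≡.refl

  count-split : ∀ n (P Q : (Fin n → Carrier) → Bool) →
                count n P ≡ count n (λ xs → P xs ∧ Q xs) ℕ.+ count n (λ xs → P xs ∧ not (Q xs))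
  count-split n P Q = ≡.trans (∑Fⁿ-cong n (λ xs → 𝟙-split (P xs) (Q xs)))
    (∑Fⁿ-distrib-+ n (λ xs → 𝟙 (P xs ∧ Q xs)) (λ xs → 𝟙 (P xs ∧ not (Q xs))))

  ∑F* : (Carrier → ℕ) → ℕ
  ∑F* T = ∑F (λ t → 𝟙 (nonzero? t) ℕ.* T t)

  ∑F*-cong : ∀ {T T′ : Carrier → ℕ} → (∀ {t} → t ≉ 0# → T t ≡ T′ t) → ∑F* T ≡ ∑F* T′
  ∑F*-cong {T} {T′} T≡T′ = ∑F-cong at
    where
    at : ∀ t → 𝟙 (nonzero? t) ℕ.* T t ≡ 𝟙 (nonzero? t) ℕ.* T′ t
    at t with t ≟ 0#
    ... | yes _   = ≡.refl
    ... | no  t≉0 = ≡.cong (ℕ._+ 0) (T≡T′ t≉0)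

  ∑F*-const : ∀ k → ∑F* (λ _ → k) ≡ (size ∸ 1) ℕ.* k
  ∑F*-const k = begin
    ∑F (λ t → 𝟙 (nonzero? t) ℕ.* k)  ≡⟨ ∑F-cong (λ t → ℕ.*-comm (𝟙 (nonzero? t)) k) ⟩
    ∑F (λ t → k ℕ.* 𝟙 (nonzero? t))  ≡⟨ ∑F-distribˡ-* k (𝟙 ∘ nonzero?) ⟩
    k ℕ.* ∑F (𝟙 ∘ nonzero?)          ≡⟨ ≡.cong (k ℕ.*_) count-nonzero ⟩
    k ℕ.* (size ∸ 1)                 ≡⟨ ℕ.*-comm k _ ⟩
    (size ∸ 1) ℕ.* k                 ∎

  ∑F*-zero : ∀ {T : Carrier → ℕ} → (∀ {t} → t ≉ 0# → T t ≡ 0) → ∑F* T ≡ 0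
  ∑F*-zero T≡0 = ≡.trans (∑F*-cong T≡0) (≡.trans (∑F*-const 0) (ℕ.*-zeroʳ (size ∸ 1)))

  ∑F*-unique : ∀ {p} {P : Carrier → Set p} (P? : ∀ t → Dec (P t)) →
               (∀ {x y} → x ≈ y → P x → P y) → UniqueNonzero P → ∑F* (λ t → 𝟙 (does (P? t))) ≡ 1
  ∑F*-unique {P = P} P? P-resp (t₀ , t₀≉0 , Pt₀ , unique) = ≡.trans (∑F-single _ resp t₀ off) at-t₀
    where
    term : Carrier → ℕ
    term t = 𝟙 (nonzero? t) ℕ.* 𝟙 (does (P? t))
    resp : ∀ {x y} → x ≈ y → term x ≡ term y
    resp x≈y = ≡.cong₂ (λ a b → 𝟙 (not a) ℕ.* 𝟙 b) (≟-cong x≈y refl)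
                       (does-⇔ (mk⇔ (P-resp x≈y) (P-resp (sym x≈y))) (P? _) (P? _))
    off : ∀ t → t ≉ t₀ → term t ≡ 0
    off t t≉t₀ with t ≟ 0#
    ... | yes _   = ≡.refl
    ... | no  t≉0 = ≡.cong (λ b → 𝟙 b ℕ.+ 0) (dec-false (P? t) (t≉t₀ ∘ unique t≉0))
    at-t₀ : term t₀ ≡ 1
    at-t₀ = ≡.cong₂ (λ a b → 𝟙 (not a) ℕ.* 𝟙 b) (dec-false (t₀ ≟ 0#) t₀≉0) (dec-true (P? t₀) Pt₀)

  ∑Fⁿ-torus : ∀ n (r : Fin n → ℕ) w → Respectsⁿ n w →
              ∑Fⁿ n (λ xs → ∑F* (λ t → w (λ j → t ^ r j * xs j))) ≡ (size ∸ 1) ℕ.* ∑Fⁿ n w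
  ∑Fⁿ-torus n r w w-resp = begin
    ∑Fⁿ n (λ xs → ∑F* (λ t → w (t · xs)))
      ≡⟨ ∑Fⁿ-∑F-comm n (λ t xs → 𝟙 (nonzero? t) ℕ.* w (t · xs)) ⟩
    ∑F (λ t → ∑Fⁿ n (λ xs → 𝟙 (nonzero? t) ℕ.* w (t · xs)))
      ≡⟨ ∑F-cong (λ t → ∑Fⁿ-distribˡ-* n (𝟙 (nonzero? t)) (w ∘ (t ·_))) ⟩
    ∑F* (λ t → ∑Fⁿ n (λ xs → w (t · xs)))   ≡⟨ ∑F*-cong invariant ⟩
    ∑F* (λ _ → ∑Fⁿ n w)                     ≡⟨ ∑F*-const _ ⟩
    (size ∸ 1) ℕ.* ∑Fⁿ n w                  ∎
    where
    _·_ : Carrier → (Fin n → Carrier) → Fin n → Carrier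
    (t · xs) j = t ^ r j * xs j
    invariant : ∀ {t} → t ≉ 0# → ∑Fⁿ n (λ xs → w (t · xs)) ≡ ∑Fⁿ n w
    invariant {t} t≉0 = ∑Fⁿ-equidistributed n (λ j → t ^ r j *_) (λ _ → id)
                      (λ j → *-equidistributed (^-nonzero (r j) t≉0)) w w-resp

  count-allNonzero : ∀ n → count n (allNonzero F n) ≡ (size ∸ 1) ℕ.^ n
  count-allNonzero zero    = ≡.refl
  count-allNonzero (suc n) = begin
    ∑F (λ x → ∑Fⁿ n (λ xs → 𝟙 (nonzero? x ∧ allNonzero F n xs)))
      ≡⟨ ∑F-cong (λ x → ≡.trans (∑Fⁿ-cong n (λ xs → 𝟙-∧ (nonzero? x) _))
                                (∑Fⁿ-distribˡ-* n (𝟙 (nonzero? x)) (𝟙 ∘ allNonzero F n))) ⟩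
    ∑F* (λ _ → count n (allNonzero F n))   ≡⟨ ∑F*-const _ ⟩
    (size ∸ 1) ℕ.* count n (allNonzero F n) ≡⟨ ≡.cong ((size ∸ 1) ℕ.*_) (count-allNonzero n) ⟩
    (size ∸ 1) ℕ.^ suc n                    ∎

  allNonzero-resp : ∀ n → Respectsⁿ n (allNonzero F n)
  allNonzero-resp zero    _     = ≡.refl
  allNonzero-resp (suc n) xs≈ys =
    ≡.cong₂ (λ a b → not a ∧ b) (≟-cong (xs≈ys zero) refl) (allNonzero-resp n (xs≈ys ∘ suc))

  allNonzero-map : ∀ n (f : Fin n → Carrier → Carrier) → (∀ j {y} → f j y ≈ 0# ⇔ y ≈ 0#) →
                   ∀ xs → allNonzero F n (λ j → f j (xs j)) ≡ allNonzero F n xs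
  allNonzero-map zero    f f≈0⇔≈0 xs = ≡.refl
  allNonzero-map (suc n) f f≈0⇔≈0 xs = ≡.cong₂ (λ a b → not a ∧ b)
    (does-⇔ (f≈0⇔≈0 zero) (_ ≟ 0#) (_ ≟ 0#))
    (allNonzero-map n (f ∘ suc) (f≈0⇔≈0 ∘ suc) (xs ∘ suc))

  allNonzero⇒nonzero : ∀ n {xs} → allNonzero F n xs ≡ true → ∀ j → xs j ≉ 0#
  allNonzero⇒nonzero (suc n) {xs} all j xⱼ≈0 with xs zero ≟ 0# | j
  ... | yes _   | _     = contradiction all λ ()
  ... | no  x≉0 | zero  = x≉0 xⱼ≈0
  ... | no  _   | suc i = allNonzero⇒nonzero n all i xⱼ≈0

  ¬allNonzero⇒zero : ∀ n {xs} → allNonzero F n xs ≡ false → ∃ λ j → xs j ≈ 0#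
  ¬allNonzero⇒zero (suc n) {xs} ¬all with xs zero ≟ 0#
  ... | yes x≈0 = zero , x≈0
  ... | no  _   = let j , xⱼ≈0 = ¬allNonzero⇒zero n ¬all in suc j , xⱼ≈0

module _ {c ℓ} (F : FiniteField c ℓ) where
  open FiniteField F hiding (zero)

  module DiagonalEquation {n : ℕ}
    (a : Fin n → Carrier) (b : Carrier) (b≉0 : b ≉ 0#)
    (m : Fin n → ℕ) (m-nonZero : ∀ j → NonZero (m j))
    (k : ℕ) .{{_ : NonZero k}} (kk : Fin n → ℕ) (kk-nonZero : ∀ j → NonZero (kk j)) where

    open FieldAlgebra F
    open Units F
    open Counting F
    open BigOperators F

    M : ℕ
    M = lcmAll n m

    r : Fin n → ℕ
    r j = _/_ M (m j) {{m-nonZero j}}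

    S K : ℕ
    S = ∑ℕ n (λ j → kk j ℕ.* r j)
    K = k ℕ.* M

    form : (Fin n → ℕ) → (Fin n → Carrier) → Carrier
    form e xs = ∑ F n (λ j → a j * xs j ^ e j)

    monomial : (Fin n → Carrier) → Carrier
    monomial xs = b * ∏ F n (λ j → xs j ^ kk j)

    solves isotropic torus : (Fin n → Carrier) → Bool
    solves xs      = does ((form m xs ^ k) ≟ monomial xs)
    isotropic xs   = does (form m xs ≟ 0#)
    torus          = allNonzero F n

    form-resp : ∀ e {xs ys} → Pointwise _≈_ xs ys → form e xs ≈ form e ys
    form-resp e xs≈ys = ∑-cong n (λ j → *-congˡ (^-congˡ (e j) (xs≈ys j)))

    monomial-resp : ∀ {xs ys} → Pointwise _≈_ xs ys → monomial xs ≈ monomial ys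
    monomial-resp xs≈ys = *-congˡ (∏-cong n (λ j → ^-congˡ (kk j) (xs≈ys j)))

    solves-resp : Respectsⁿ n solves
    solves-resp xs≈ys = ≟-cong (^-congˡ k (form-resp m xs≈ys)) (monomial-resp xs≈ys)

    isotropic-resp : ∀ e → Respectsⁿ n (λ xs → does (form e xs ≟ 0#))
    isotropic-resp e xs≈ys = ≟-cong (form-resp e xs≈ys) refl

    _·_ : Carrier → (Fin n → Carrier) → Fin n → Carrier
    (t · xs) j = t ^ r j * xs j

    form-scale : ∀ t xs → form m (t · xs) ≈ t ^ M * form m xs
    form-scale t xs = trans (∑-cong n term) (*-distribˡ-∑ n (t ^ M) (λ j → a j * xs j ^ m j))
      where
      open ≈-Reasoning
      term : ∀ j → a j * (t ^ r j * xs j) ^ m j ≈ t ^ M * (a j * xs j ^ m j)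
      term j = begin
        a j * (t ^ r j * xs j) ^ m j          ≈⟨ *-congˡ (^-distrib-* (t ^ r j) (xs j) (m j)) ⟩
        a j * ((t ^ r j) ^ m j * xs j ^ m j)  ≈⟨ *-congˡ (*-congʳ (^-assocʳ t (r j) (m j))) ⟩
        a j * (t ^ (r j ℕ.* m j) * xs j ^ m j) ≡⟨ ≡.cong (λ e → a j * (t ^ e * xs j ^ m j))
                                                    (m/n*n≡m {{m-nonZero j}} (m∣lcmAll n m j)) ⟩
        a j * (t ^ M * xs j ^ m j)            ≈⟨ x∙yz≈y∙xz (a j) (t ^ M) (xs j ^ m j) ⟩
        t ^ M * (a j * xs j ^ m j)            ∎

    monomial-scale : ∀ t xs → monomial (t · xs) ≈ t ^ S * monomial xs
    monomial-scale t xs = begin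
      b * ∏ F n (λ j → (t ^ r j * xs j) ^ kk j)                  ≈⟨ *-congˡ (∏-cong n term) ⟩
      b * ∏ F n (λ j → t ^ (kk j ℕ.* r j) * xs j ^ kk j)         ≈⟨ *-congˡ (∏-distrib-* n _ _) ⟩
      b * (∏ F n (λ j → t ^ (kk j ℕ.* r j)) * ∏ F n (λ j → xs j ^ kk j))
                                                                 ≈⟨ *-congˡ (*-congʳ (∏-^ n t _)) ⟩
      b * (t ^ S * ∏ F n (λ j → xs j ^ kk j))                    ≈⟨ x∙yz≈y∙xz b (t ^ S) _ ⟩
      t ^ S * monomial xs                                        ∎
      where
      open ≈-Reasoning
      term : ∀ j → (t ^ r j * xs j) ^ kk j ≈ t ^ (kk j ℕ.* r j) * xs j ^ kk j
      term j = trans (^-distrib-* _ _ (kk j)) (*-congʳ (trans (^-assocʳ t (r j) (kk j))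
                 (reflexive (≡.cong (t ^_) (ℕ.*-comm (r j) (kk j))))))

    solves-scale : ∀ t xs → solves (t · xs) ≡ does ((t ^ K * form m xs ^ k) ≟ (t ^ S * monomial xs))
    solves-scale t xs = ≟-cong (trans (^-congˡ k (form-scale t xs)) (trans (^-distrib-* _ _ k)
      (*-congʳ (trans (^-assocʳ t M k) (reflexive (≡.cong (t ^_) (ℕ.*-comm M k)))))))
      (monomial-scale t xs)

    torus-scale : ∀ {t} → t ≉ 0# → ∀ xs → torus (t · xs) ≡ torus xs
    torus-scale {t} t≉0 = allNonzero-map n (λ j → t ^ r j *_) λ j → mk⇔
      (λ ty≈0 → *-cancelˡ (^-nonzero (r j) t≉0) (trans ty≈0 (sym (zeroʳ _))))
      (λ y≈0 → trans (*-congˡ y≈0) (zeroʳ _))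

    torus-^ : ∀ (e : Fin n → ℕ) → (∀ j → NonZero (e j)) → ∀ xs → torus (λ j → xs j ^ e j) ≡ torus xs
    torus-^ e e-nonZero = allNonzero-map n (λ j → _^ e j) (λ j → ^≈0⇔≈0 (e j) {{e-nonZero j}})

    monomial-nonzero : ∀ {xs} → torus xs ≡ true → monomial xs ≉ 0#
    monomial-nonzero all = *-nonzero b≉0 (∏-nonzero n _ λ j →
      ^-nonzero (kk j) (allNonzero⇒nonzero n all j))

    off-torus : ∀ {xs} → torus xs ≡ false → solves xs ≡ isotropic xs
    off-torus {xs} ¬all with ¬allNonzero⇒zero n ¬all
    ... | j , xⱼ≈0 = does-⇔ (mk⇔ (λ fᵏ≈0 → ^≈0⇒≈0 k (trans fᵏ≈0 monomial≈0))
                                   (λ f≈0 → trans (^-congˡ k f≈0) (trans (0^n≈0 k) (sym monomial≈0))))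
                            (_ ≟ _) (_ ≟ _)
      where
      monomial≈0 : monomial xs ≈ 0#
      monomial≈0 = trans (*-congˡ (∏-zero n _ j (trans (^-congˡ (kk j) xⱼ≈0) (0^n≈0 (kk j) {{kk-nonZero j}}))))
                         (zeroʳ b)

    orbit : gcd ℕ.∣ S - K ∣ (size ∸ 1) ≡ 1 → ∀ xs →
            ∑F* (λ t → 𝟙 (solves (t · xs) ∧ torus (t · xs))) ≡ 𝟙 (torus xs ∧ not (isotropic xs))
    orbit coprime xs = begin
      ∑F* (λ t → 𝟙 (solves (t · xs) ∧ torus (t · xs)))
        ≡⟨ ∑F*-cong (λ {t} t≉0 → ≡.cong 𝟙 (≡.cong₂ _∧_ (solves-scale t xs) (torus-scale t≉0 xs))) ⟩
      ∑F* (λ t → 𝟙 (does (balances? t) ∧ torus xs))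
        ≡⟨ count-balancing (torus xs) ≡.refl ⟩
      𝟙 (torus xs ∧ not (isotropic xs))
        ∎
      where
      open ≡.≡-Reasoning
      Balances : Carrier → Set _
      Balances t = t ^ K * form m xs ^ k ≈ t ^ S * monomial xs
      balances? : ∀ t → Dec (Balances t)
      balances? t = (t ^ K * form m xs ^ k) ≟ (t ^ S * monomial xs)
      balances-resp : ∀ {t t′} → t ≈ t′ → Balances t → Balances t′
      balances-resp t≈t′ bal = trans (*-congʳ (^-congˡ K (sym t≈t′))) (trans bal (*-congʳ (^-congˡ S t≈t′)))
      no-balance : ∀ {t} → t ≉ 0# → form m xs ≈ 0# → torus xs ≡ true → does (balances? t) ≡ false
      no-balance {t} t≉0 f≈0 all = dec-false (balances? t) λ bal →
        *-nonzero (^-nonzero S t≉0) (monomial-nonzero all)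
          (trans (sym bal) (trans (*-congˡ (trans (^-congˡ k f≈0) (0^n≈0 k))) (zeroʳ _)))
      count-balancing : ∀ A → torus xs ≡ A →
                        ∑F* (λ t → 𝟙 (does (balances? t) ∧ A)) ≡ 𝟙 (A ∧ not (isotropic xs))
      count-balancing false _ = ∑F*-zero (λ {t} _ → ≡.cong 𝟙 (Bool.∧-zeroʳ (does (balances? t))))
      count-balancing true all with form m xs ≟ 0#
      ... | yes f≈0 = ∑F*-zero (λ t≉0 → ≡.cong (λ z → 𝟙 (z ∧ true)) (no-balance t≉0 f≈0 all))
      ... | no  f≉0 = ≡.trans (∑F*-cong (λ {t} _ → ≡.cong 𝟙 (Bool.∧-identityʳ (does (balances? t)))))
                        (∑F*-unique balances? balances-resp
                          (balancing-unique K S coprime (^-nonzero k f≉0) (monomial-nonzero all)))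

    solutions-on-torus zeros-on-torus zeros-off-torus : ℕ
    solutions-on-torus = count n (λ xs → solves xs ∧ torus xs)
    zeros-on-torus     = count n (λ xs → torus xs ∧ isotropic xs)
    zeros-off-torus    = count n (λ xs → isotropic xs ∧ not (torus xs))

    orbit-count : gcd ℕ.∣ S - K ∣ (size ∸ 1) ≡ 1 →
                  (size ∸ 1) ℕ.* solutions-on-torus ≡ count n (λ xs → torus xs ∧ not (isotropic xs))
    orbit-count coprime = ≡.trans (≡.sym (∑Fⁿ-torus n r (λ xs → 𝟙 (solves xs ∧ torus xs)) resp))
                                  (∑Fⁿ-cong n (orbit coprime))
      where
      resp : Respectsⁿ n (λ xs → 𝟙 (solves xs ∧ torus xs))
      resp xs≈ys = ≡.cong₂ (λ s t → 𝟙 (s ∧ t)) (solves-resp xs≈ys) (allNonzero-resp n xs≈ys)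

    d : Fin n → ℕ
    d j = gcd (m j) (size ∸ 1)

    d-nonZero : ∀ j → NonZero (d j)
    d-nonZero j = gcd-nonZeroˡ (m j) (size ∸ 1) {{m-nonZero j}}

    count-pow-gcd : ∀ w → Respectsⁿ n w →
                    ∑Fⁿ n (λ xs → w (λ j → xs j ^ m j)) ≡ ∑Fⁿ n (λ xs → w (λ j → xs j ^ d j))
    count-pow-gcd = ∑Fⁿ-equidistributed n (λ j → _^ m j) (λ j → _^ d j)
                      (λ j → ^-equidistributed-gcd (m j) {{m-nonZero j}})

    linear-isotropic : (Fin n → Carrier) → Bool
    linear-isotropic ys = does (∑ F n (λ j → a j * ys j) ≟ 0#)

    linear-isotropic-resp : Respectsⁿ n linear-isotropic
    linear-isotropic-resp ys≈ys′ = ≟-cong (∑-cong n (λ j → *-congˡ (ys≈ys′ j))) refl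

    count-solutions : N F n (λ xs → form m xs ^ k) monomial ≡ solutions-on-torus ℕ.+ zeros-off-torus
    count-solutions = begin
      N F n (λ xs → form m xs ^ k) monomial  ≡⟨ countPts≡count n solves solves-resp ⟩
      count n solves                         ≡⟨ count-split n solves torus ⟩
      solutions-on-torus ℕ.+ count n (λ xs → solves xs ∧ not (torus xs))
        ≡⟨ ≡.cong (solutions-on-torus ℕ.+_) (∑Fⁿ-cong n (≡.cong 𝟙 ∘ off)) ⟩
      solutions-on-torus ℕ.+ zeros-off-torus ∎
      where
      open ≡.≡-Reasoning
      off : ∀ xs → solves xs ∧ not (torus xs) ≡ isotropic xs ∧ not (torus xs)
      off xs with torus xs in eq
      ... | true  = ≡.trans (Bool.∧-zeroʳ _) (≡.sym (Bool.∧-zeroʳ _))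
      ... | false = ≡.cong (_∧ true) (off-torus eq)

    count-isotropic : N F n (form d) (λ _ → 0#) ≡ zeros-on-torus ℕ.+ zeros-off-torus
    count-isotropic = begin
      N F n (form d) (λ _ → 0#)
        ≡⟨ countPts≡count n _ (isotropic-resp d) ⟩
      ∑Fⁿ n (λ xs → 𝟙 (linear-isotropic (λ j → xs j ^ d j)))
        ≡⟨ count-pow-gcd (𝟙 ∘ linear-isotropic) (≡.cong 𝟙 ∘ linear-isotropic-resp) ⟨
      count n isotropic
        ≡⟨ count-split n isotropic torus ⟩
      count n (λ xs → isotropic xs ∧ torus xs) ℕ.+ zeros-off-torus
        ≡⟨ ≡.cong (ℕ._+ zeros-off-torus) (∑Fⁿ-cong n (λ xs → ≡.cong 𝟙 (Bool.∧-comm (isotropic xs) (torus xs)))) ⟩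
      zeros-on-torus ℕ.+ zeros-off-torus
        ∎
      where open ≡.≡-Reasoning

    count-isotropic* : N* F n (form d) (λ _ → 0#) ≡ zeros-on-torus
    count-isotropic* = begin
      N* F n (form d) (λ _ → 0#)
        ≡⟨ countPts≡count n _ (λ xs≈ys → ≡.cong₂ _∧_ (allNonzero-resp n xs≈ys) (isotropic-resp d xs≈ys)) ⟩
      count n (λ xs → torus xs ∧ does (form d xs ≟ 0#))
        ≡⟨ ∑Fⁿ-cong n (λ xs → ≡.cong (λ A → 𝟙 (A ∧ does (form d xs ≟ 0#))) (torus-^ d d-nonZero xs)) ⟨
      ∑Fⁿ n (λ xs → w (λ j → xs j ^ d j))
        ≡⟨ count-pow-gcd w w-resp ⟨
      ∑Fⁿ n (λ xs → w (λ j → xs j ^ m j))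
        ≡⟨ ∑Fⁿ-cong n (λ xs → ≡.cong (λ A → 𝟙 (A ∧ isotropic xs)) (torus-^ m m-nonZero xs)) ⟩
      zeros-on-torus
        ∎
      where
      open ≡.≡-Reasoning
      w : (Fin n → Carrier) → ℕ
      w ys = 𝟙 (allNonzero F n ys ∧ linear-isotropic ys)
      w-resp : Respectsⁿ n w
      w-resp ys≈ys′ = ≡.cong₂ (λ A Z → 𝟙 (A ∧ Z)) (allNonzero-resp n ys≈ys′) (linear-isotropic-resp ys≈ys′)

    count-torus : gcd ℕ.∣ S - K ∣ (size ∸ 1) ≡ 1 →
                  (size ∸ 1) ℕ.^ n ≡ zeros-on-torus ℕ.+ (size ∸ 1) ℕ.* solutions-on-torus
    count-torus coprime = begin
      (size ∸ 1) ℕ.^ n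
        ≡⟨ count-allNonzero n ⟨
      count n torus
        ≡⟨ count-split n torus isotropic ⟩
      zeros-on-torus ℕ.+ count n (λ xs → torus xs ∧ not (isotropic xs))
        ≡⟨ ≡.cong (zeros-on-torus ℕ.+_) (orbit-count coprime) ⟨
      zeros-on-torus ℕ.+ (size ∸ 1) ℕ.* solutions-on-torus
        ∎
      where open ≡.≡-Reasoning

open ≡.≡-Reasoning

∣m⊖n∣≡∣m-n∣ : ∀ m n → ℤ.∣ m ⊖ n ∣ ≡ ℕ.∣ m - n ∣
∣m⊖n∣≡∣m-n∣ m n with ℕ.≤-total m n
... | inj₁ m≤n = ≡.trans (ℤ.∣⊖∣-≤ m≤n) (≡.sym (ℕ.m≤n⇒∣m-n∣≡n∸m m≤n))
... | inj₂ n≤m = begin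
  ℤ.∣ m ⊖ n ∣  ≡⟨ ℤ.∣m⊖n∣≡∣n⊖m∣ m n ⟩
  ℤ.∣ n ⊖ m ∣  ≡⟨ ℤ.∣⊖∣-≤ n≤m ⟩
  m ∸ n        ≡⟨ ℕ.m≤n⇒∣n-m∣≡n∸m n≤m ⟨
  ℕ.∣ m - n ∣  ∎

coprime-difference : ∀ m n p → gcdℤ (+ m ℤ.- + n) (+ p) ≡ 1ℤ → gcd ℕ.∣ m - n ∣ p ≡ 1
coprime-difference m n p coprime = begin
  gcd ℕ.∣ m - n ∣ p              ≡⟨ ≡.cong (λ z → gcd z p) (∣m⊖n∣≡∣m-n∣ m n) ⟨
  gcd ℤ.∣ m ⊖ n ∣ p              ≡⟨ ≡.cong (λ z → gcd ℤ.∣ z ∣ p) (ℤ.m-n≡m⊖n m n) ⟨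
  gcd ℤ.∣ + m ℤ.- + n ∣ p        ≡⟨ ℤ.+-injective coprime ⟩
  1                              ∎

+-≡-∸ : ∀ {a b c} → a ℕ.+ c ≡ b → + a ≡ + b ℤ.- + c
+-≡-∸ {a} {b} {c} ≡.refl = begin
  + a                 ≡⟨ ≡.cong +_ (ℕ.m+n∸n≡m a c) ⟨
  + (a ℕ.+ c ∸ c)     ≡⟨ ℤ.⊖-≥ (ℕ.m≤n+m c a) ⟨
  (a ℕ.+ c) ⊖ c       ≡⟨ ℤ.m-n≡m⊖n (a ℕ.+ c) c ⟨
  + (a ℕ.+ c) ℤ.- + c ∎

counting-identity : ∀ {p q P NE Nd Ns X Y Z} → q ≡ suc p → P ≡ Z ℕ.+ p ℕ.* X →
                    NE ≡ X ℕ.+ Y → Nd ≡ Z ℕ.+ Y → Ns ≡ Z →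
                    + p ℤ.* + NE ≡ + P ℤ.+ + p ℤ.* + Nd ℤ.- + q ℤ.* + Ns
counting-identity {p} {X = X} {Y} {Z} ≡.refl ≡.refl ≡.refl ≡.refl ≡.refl = begin
  + p ℤ.* + (X ℕ.+ Y)                                        ≡⟨ ℤ.pos-* p _ ⟨
  + (p ℕ.* (X ℕ.+ Y))                                        ≡⟨ +-≡-∸ (solve 4 (λ p X Y Z →
      p :* (X :+ Y) :+ (con 1 :+ p) :* Z := (Z :+ p :* X) :+ p :* (Z :+ Y)) ≡.refl p X Y Z) ⟩
  + ((Z ℕ.+ p ℕ.* X) ℕ.+ p ℕ.* (Z ℕ.+ Y)) ℤ.- + (suc p ℕ.* Z)
    ≡⟨ ≡.cong₂ (λ u v → u ℤ.- v)
         (≡.trans (ℤ.pos-+ (Z ℕ.+ p ℕ.* X) (p ℕ.* (Z ℕ.+ Y))) (≡.cong (ℤ._+_ (+ (Z ℕ.+ p ℕ.* X))) (ℤ.pos-* p _)))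
         (ℤ.pos-* (suc p) Z) ⟩
  + (Z ℕ.+ p ℕ.* X) ℤ.+ + p ℤ.* + (Z ℕ.+ Y) ℤ.- + suc p ℤ.* + Z ∎
  where open +-*-Solver

theorem3 : ∀ {c ℓ} (F : FiniteField c ℓ) (n : ℕ) → 2 ≤ n →
  let open FiniteField F in
  (a : Fin n → Carrier) → (∀ j → ¬ (a j ≈ 0#)) →
  (b : Carrier) → ¬ (b ≈ 0#) →
  (m : Fin n → ℕ) → (mpos : ∀ j → NonZero (m j)) →
  (k : ℕ) → 0 < k →
  (kk : Fin n → ℕ) → (∀ j → 0 < kk j) →
  let q = size
      d = λ j → gcd (m j) (q ∸ 1)
      M = lcmAll n m
  in
  gcdℤ ((+ ∑ℕ n (λ j → kk j ℕ.* _/_ M (m j) {{mpos j}})) ℤ.- (+ (k ℕ.* M))) (+ (q ∸ 1)) ≡ 1ℤ →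
  -- (q-1) · N[(Σ aⱼxⱼ^mⱼ)^k = b ∏ xⱼ^kⱼ]
  --   = (q-1)^n + (q-1) · N[Σ aⱼxⱼ^dⱼ = 0] - q · N*[Σ aⱼxⱼ^dⱼ = 0]
  (+ (q ∸ 1)) ℤ.* (+ N F n (λ x → pow F (∑ F n (λ j → a j * pow F (x j) (m j))) k)
                         (λ x → b * ∏ F n (λ j → pow F (x j) (kk j))))
    ≡ (+ ((q ∸ 1) ℕ.^ n))
      ℤ.+ (+ (q ∸ 1)) ℤ.* (+ N F n (λ x → ∑ F n (λ j → a j * pow F (x j) (d j))) (λ x → 0#))
      ℤ.- (+ q) ℤ.* (+ N* F n (λ x → ∑ F n (λ j → a j * pow F (x j) (d j))) (λ x → 0#))
theorem3 F n _ a _ b b≉0 m m-nonZero k k>0 kk kk>0 coprime =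
  counting-identity q≡suc[q-1] (count-torus (coprime-difference S K (size ∸ 1) coprime))
    count-solutions count-isotropic count-isotropic*
  where
  open FiniteField F using (size)
  open Units F using (q≡suc[q-1])
  open DiagonalEquation F a b b≉0 m m-nonZero k {{ℕ.>-nonZero k>0}} kk (λ j → ℕ.>-nonZero (kk>0 j))
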